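{- Let $\mathcal{L}_1$ and $\mathcal{L}_2$ be LTSs and let $\mathcal{F}$ be the set of reachable FD-witnesses of $\mathsf{norm}_{\mathsf{fdr}}(\mathcal{L}_1)\ltimes\mathcal{L}_2$. For all states $(U,s)$ of $\mathsf{norm}_{\mathsf{fdr}}(\mathcal{L}_1)\ltimes\mathcal{L}_2$: if some state in $U$ diverges, then $\mathsf{Dist}_{\mathcal{F}}((U,s))=\infty$.
   Context: Fix a finite set $\mathit{Act}$ of actions not containing the internal action $\tau$; $\mathit{Act}_\tau=\mathit{Act}\cup\{\tau\}$. An LTS is $(S,\iota,\rightarrow)$ with $\iota\in S$ and $\rightarrow\subseteq S\times\mathit{Act}_\tau\times S$; $\mathsf{enabled}(s)=\{a\in\mathit{Act}_\tau\mid\exists t: s\xrightarrow{a}t\}$. For $\sigma\in\mathit{Act}_\tau^*$, $s\overset{\sigma}{\twoheadrightarrow}t$ means there is a path from $s$ to $t$ whose labels, in order, form exactly $\sigma$; a state is reachable if the initial state reaches it by some $\sigma$. The weak transition $s\overset{a}{\Longrightarrow}t$ ($a\in\mathit{Act}$) holds iff there is a path from $s$ to $t$ consisting of $\tau$-transitions, one $a$-transition, and $\tau$-transitions; $s\overset{\epsilon}{\Longrightarrow}t$ iff $t$ is reachable from $s$ by $\tau$-transitions only. A state $s$ is stable if $\tau\notin\mathsf{enabled}(s)$; for stable $s$, $\mathsf{refusals}(s)=\mathcal{P}(\mathit{Act}\setminus\mathsf{enabled}(s))$; for a set $U$, $\mathsf{refusals}(U)=\{X\subseteq\mathit{Act}\mid\exists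 s\in U: s\text{ stable}\wedge X\in\mathsf{refusals}(s)\}$. A state diverges if there is an infinite sequence of $\tau$-transitions from it; a set diverges if one of its states does. For $\mathcal{L}_1=(S_1,\iota_1,\rightarrow_1)$, $\mathsf{norm}_{\mathsf{fdr}}(\mathcal{L}_1)$ has states $\mathcal{P}(S_1)$, initial state $\{s\mid\iota_1\overset{\epsilon}{\Longrightarrow}s\}$, and for $U,V\subseteq S_1$, $a\in\mathit{Act}$: $U\xrightarrow{a}V$ iff $U$ does not diverge and $V=\{t\mid\exists s\in U: s\overset{a}{\Longrightarrow}t\}$. For $\mathcal{L}_2=(S_2,\iota_2,\rightarrow_2)$, the product $\mathcal{M}\ltimes\mathcal{L}_2$ of $\mathcal{M}=(T,\iota_T,\rightarrow_T)$ and $\mathcal{L}_2$ has states $T\times S_2$, initial state $(\iota_T,\iota_2)$, and the smallest transition relation with $(u,s)\xrightarrow{\tau}(u,t)$ if $s\xrightarrow{\tau}_2t$, and $(u,s)\xrightarrow{a}(u',t)$ if $u\xrightarrow{a}_Tu'$ and $s\xrightarrow{a}_2t$ for $a\in\mathit{Act}$. A state $(U,s)$ of $\mathsf{norm}_{\mathsf{fdr}}(\mathcal{L}_1)\ltimes\mathcal{L}_2$ is an FD-witness iff $U$ does not diverge and at least one holds: $U=\emptyset$; or $s$ is stable and $\mathsf{refusals}(s)\not\subseteq\mathsf{refusals}(U)$; or $s$ diverges. For a state $x$ of the product and a set $F$ of its states, $\mathsf{Dist}_F(x)=\min\{|\sigma|\mid\sigma\in\mathit{Act}_\tau^*,\ y\in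 F,\ x\overset{\sigma}{\twoheadrightarrow}y\}$, with $\min\emptyset=\infty$. -}

module Defs where

open import Level using (Level; _⊔_; 0ℓ) renaming (suc to lsuc)
open import Data.Nat using (ℕ; suc)
open import Data.Fin using (Fin)
open import Data.Fin.Subset using (Subset; _∈_; _∉_)
open import Data.List using (List; []; _∷_)
open import Data.Product using (Σ; ∃; ∃-syntax; _×_; _,_)
open import Data.Sum using (_⊎_)
open import Relation.Nullary using (¬_)
open import Relation.Binary.PropositionalEquality using (_≡_)
open import Relation.Binary.Construct.Closure.ReflexiveTransitive using (Star)

data Actτ (n : ℕ) : Set where
  τ   : Actτ n
  act : Fin n → Actτ n

record LTS (ℓ : Level) (n : ℕ) : Set (lsuc ℓ) where
  field
    State : Set ℓ
    init  : State
    _⟶⟨_⟩_ : State → Actτ n → State → Set ℓ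

module _ {ℓ : Level} {n : ℕ} (L : LTS ℓ n) where
  open LTS L

  Enabled : State → Actτ n → Set ℓ
  Enabled s a = ∃[ t ] (s ⟶⟨ a ⟩ t)

  data Path : State → List (Actτ n) → State → Set ℓ where
    here : ∀ {s} → Path s [] s
    step : ∀ {s u t a σ} → s ⟶⟨ a ⟩ u → Path u σ t → Path s (a ∷ σ) t

  Reachable : State → Set ℓ
  Reachable t = ∃[ σ ] Path init σ t

  _⟶τ_ : State → State → Set ℓ
  s ⟶τ t = s ⟶⟨ τ ⟩ t

  _=ε⇒_ : State → State → Set ℓ
  _=ε⇒_ = Star _⟶τ_

  _=⟨_⟩⇒_ : State → Fin n → State → Set ℓ
  s =⟨ a ⟩⇒ t = ∃[ u ] ∃[ v ] (s =ε⇒ u × u ⟶⟨ act a ⟩ v × v =ε⇒ t)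

  Stable : State → Set ℓ
  Stable s = ¬ Enabled s τ

  -- X ∈ refusals(s)  (used only for stable s): X ⊆ Act ∖ enabled(s)
  InRefusals : State → Subset n → Set ℓ
  InRefusals s X = ∀ a → a ∈ X → ¬ Enabled s (act a)

  InRefusalsSet : (State → Set ℓ) → Subset n → Set ℓ
  InRefusalsSet U X = ∃[ s ] (U s × Stable s × InRefusals s X)

  Diverges : State → Set ℓ
  Diverges s = Σ (ℕ → State) λ f → f 0 ≡ s × (∀ i → f i ⟶τ f (suc i))

  DivergesSet : (State → Set ℓ) → Set ℓ
  DivergesSet U = ∃[ s ] (U s × Diverges s)

  -- Dist_F(x) = ∞ : the set {|σ| | y ∈ F, x ↠σ y} is empty (min ∅ = ∞;
  -- the minimum of a nonempty set of naturals is finite).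
  DistInfinite : (State → Set ℓ) → State → Set ℓ
  DistInfinite F x = ¬ (∃[ σ ] ∃[ y ] (F y × Path x σ y))

-- norm_fdr(L1): states are subsets of S1 (predicates)
module _ {n : ℕ} (L : LTS 0ℓ n) where
  open LTS L

  post : (State → Set) → Fin n → (State → Set)
  post U a t = ∃[ s ] (U s × _=⟨_⟩⇒_ L s a t)

  data NormStep : (State → Set) → Actτ n → (State → Set) → Set₁ where
    nstep : ∀ {U V a} → ¬ DivergesSet L U → V ≡ post U a → NormStep U (act a) V

  normFdr : LTS (lsuc 0ℓ) n
  normFdr = record
    { State = State → Set
    ; init = λ s → _=ε⇒_ L init s
    ; _⟶⟨_⟩_ = NormStep }

module _ {ℓ ℓ' : Level} {n : ℕ} (M : LTS ℓ n) (L : LTS ℓ' n) where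
  open LTS M renaming (State to T; init to ιT; _⟶⟨_⟩_ to _⟶T⟨_⟩_)
  open LTS L renaming (State to S; init to ιS; _⟶⟨_⟩_ to _⟶S⟨_⟩_)

  data ProdStep : T × S → Actτ n → T × S → Set (ℓ ⊔ ℓ') where
    ptau : ∀ {u s t} → s ⟶S⟨ τ ⟩ t → ProdStep (u , s) τ (u , t)
    pact : ∀ {u u' s t a} → u ⟶T⟨ act a ⟩ u' → s ⟶S⟨ act a ⟩ t
         → ProdStep (u , s) (act a) (u' , t)

  _⋉_ : LTS (ℓ ⊔ ℓ') n
  _⋉_ = record { State = T × S ; init = (ιT , ιS) ; _⟶⟨_⟩_ = ProdStep }

module _ {n : ℕ} (L1 L2 : LTS 0ℓ n) where
  Prod : LTS (lsuc 0ℓ) n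
  Prod = normFdr L1 ⋉ L2

  IsEmpty : (LTS.State L1 → Set) → Set
  IsEmpty U = ∀ s → ¬ U s

  FDWitness : LTS.State Prod → Set
  FDWitness (U , s) =
    ¬ DivergesSet L1 U ×
    (  IsEmpty U
     ⊎ (Stable L2 s × ∃[ X ] (InRefusals L2 s X × ¬ InRefusalsSet L1 U X))
     ⊎ Diverges L2 s)

  ReachableFDWitness : LTS.State Prod → Set₁
  ReachableFDWitness x = Reachable Prod x × FDWitness x

module Submission where

-- In a product M ⋉ L a τ-step leaves the M-component unchanged
-- and a visible step moves it along a transition of M.  Hence any property of
-- M-states that is preserved by M's visible transitions is an invariant of
-- every path of M ⋉ L (lemma `closed⇒pathInvariant`).  In norm_fdr(L1) a
-- diverging set U has no outgoing transitions at all, so "U diverges" is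
-- trivially preserved (lemma `divergence-closed`).  Therefore every state
-- reachable from (U , s) with U diverging still has a diverging first
-- component, whereas an FD-witness requires a non-diverging one: no
-- FD-witness (reachable or not) is reachable from (U , s), i.e. its distance
-- to the set of reachable FD-witnesses is ∞.

open import Defs
open import Level using (0ℓ; _⊔_)
open import Data.Nat using (ℕ)
open import Data.Product using (_,_; proj₁)

ClosedUnderVisible : ∀ {ℓ ℓP} {n : ℕ} (M : LTS ℓ n) → (LTS.State M → Set ℓP) → Set (ℓ ⊔ ℓP)
ClosedUnderVisible M P =
  ∀ {u u' : LTS.State M} {a} → LTS._⟶⟨_⟩_ M u (act a) u' → P u → P u'

-- Such a property of the first component is invariant along all paths of
-- the product M ⋉ L, since τ-steps of the product do not move M at all.
closed⇒pathInvariant :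
  ∀ {ℓ ℓ' ℓP} {n : ℕ} (M : LTS ℓ n) (L : LTS ℓ' n) (P : LTS.State M → Set ℓP)
  → ClosedUnderVisible M P
  → ∀ {x σ y} → Path (M ⋉ L) x σ y → P (proj₁ x) → P (proj₁ y)
closed⇒pathInvariant M L P closed here                    p = p
closed⇒pathInvariant M L P closed (step (ptau _) path)     p =
  closed⇒pathInvariant M L P closed path p
closed⇒pathInvariant M L P closed (step (pact u⟶u' _) path) p =
  closed⇒pathInvariant M L P closed path (closed u⟶u' p)

-- A diverging state of norm_fdr(L1) has no transitions (they all require
-- non-divergence), so divergence is vacuously closed under them.
divergence-closed : {n : ℕ} (L1 : LTS 0ℓ n) → ClosedUnderVisible (normFdr L1) (DivergesSet L1)
divergence-closed L1 (nstep notDiverging _) diverging with () ← notDiverging diverging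

lemma5p12 : {n : ℕ} (L1 L2 : LTS 0ℓ n) (U : LTS.State L1 → Set) (s : LTS.State L2)
    → DivergesSet L1 U
    → DistInfinite (Prod L1 L2) (ReachableFDWitness L1 L2) (U , s)
lemma5p12 L1 L2 U s diverging (σ , y , (_ , (notDiverging , _)) , path) =
  notDiverging
    (closed⇒pathInvariant (normFdr L1) L2 (DivergesSet L1) (divergence-closed L1)
      path diverging)
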